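{- Let $G=(X,Y)$ be a bipartite graph satisfying the double Hall property with $|X|=n\ge 2$ and maximum degree $\Delta(G)=d$. Then $n\le \binom d2+1$; consequently $d\ge \sqrt{2n}$.
   Context: All graphs are finite and simple. For a vertex set $S$, $\Lambda^2(S)$ denotes the set of vertices adjacent to at least two vertices of $S$. A bipartite graph $G=(X,Y)$ with $|X|\ge 2$ satisfies the double Hall property if $|\Lambda^2(S)|\ge |S|$ for every $S\subseteq X$ with $|S|\ge 2$. -}

module Defs where

open import Data.Bool using (Bool)
open import Data.Nat using (ℕ; _≤_; _≤ᵇ_)
open import Data.Fin using (Fin)
open import Data.Fin.Subset using (Subset; _∩_; ∣_∣)
open import Data.Vec using (tabulate)
open import Data.Product using (_×_; ∃)
open import Data.Sum using (_⊎_)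
open import Relation.Binary.PropositionalEquality using (_≡_)

BipGraph : ℕ → ℕ → Set
BipGraph n m = Fin n → Fin m → Bool

module _ {n m : ℕ} (G : BipGraph n m) where

  nbrX : Fin n → Subset m
  nbrX x = tabulate (G x)

  nbrY : Fin m → Subset n
  nbrY y = tabulate (λ x → G x y)

  degX : Fin n → ℕ
  degX x = ∣ nbrX x ∣

  degY : Fin m → ℕ
  degY y = ∣ nbrY y ∣

  Λ² : Subset n → Subset m
  Λ² S = tabulate (λ y → 2 ≤ᵇ ∣ S ∩ nbrY y ∣)

  DoubleHall : Set
  DoubleHall = (S : Subset n) → 2 ≤ ∣ S ∣ → ∣ S ∣ ≤ ∣ Λ² S ∣

  MaxDegree : ℕ → Set
  MaxDegree d =
    ((x : Fin n) → degX x ≤ d) × ((y : Fin m) → degY y ≤ d) ×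
    ((∃ λ x → degX x ≡ d) ⊎ (∃ λ y → degY y ≡ d))

{-# OPTIONS --safe #-}
module Submission where

-- Fix x₀ ∈ X. The double Hall property for a pair {x₀, x} says exactly that
-- x₀ and x have at least two common neighbours. Counting the pairs (x, y)
-- with x ≠ x₀ and y a common neighbour of x₀ and x therefore gives
-- 2 (n − 1) ≤ ∑_{y ∈ N(x₀)} (deg y − 1) ≤ d (d − 1).

open import Defs
open import Data.Nat using (ℕ; _≤_; _+_; _*_)
open import Data.Nat.Combinatorics using (_C_)
open import Data.Product using (_×_)

open import Data.Bool using (Bool; true; false; _∧_; if_then_else_)
open import Data.Fin using (Fin; zero; suc)
open import Data.Fin.Subset using (Subset; inside; _∩_; ∣_∣; ⁅_⁆; ⊥)
open import Data.Fin.Subset.Properties using (∣⁅x⁆∣≡1; ∣⊥∣≡0; ∩-idem; ∩-zeroˡ)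
open import Data.Nat using (zero; suc; _∸_; _<_; _≤ᵇ_; z≤n; s≤s)
open import Data.Nat.Combinatorics using (nCk+nC[k+1]≡[n+1]C[k+1]; nC1≡n)
open import Data.Nat.Properties
open import Data.Nat.Solver using (module +-*-Solver)
open import Data.Product using (_,_)
open import Data.Vec using (_∷_; tabulate)
open import Data.Vec.Properties using (tabulate-cong)
open import Relation.Binary.PropositionalEquality

open import Algebra.Properties.Semiring.Sum +-*-semiring
  using (sum; sum-syntax; sum-cong-≗; ∑-comm; *-distribˡ-sum; *-distribʳ-sum)

𝟙 : Bool → ℕ
𝟙 b = if b then 1 else 0

𝟙-∧ : ∀ a b → 𝟙 (a ∧ b) ≡ 𝟙 a * 𝟙 b
𝟙-∧ true  b = sym (+-identityʳ (𝟙 b))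
𝟙-∧ false b = refl

2≤ᵇ𝟙+𝟙 : ∀ a b → (2 ≤ᵇ 𝟙 a + 𝟙 b) ≡ a ∧ b
2≤ᵇ𝟙+𝟙 true  true  = refl
2≤ᵇ𝟙+𝟙 true  false = refl
2≤ᵇ𝟙+𝟙 false true  = refl
2≤ᵇ𝟙+𝟙 false false = refl

sum-mono-≤ : ∀ {k} {f g : Fin k → ℕ} → (∀ i → f i ≤ g i) → sum f ≤ sum g
sum-mono-≤ {zero}  f≤g = z≤n
sum-mono-≤ {suc k} f≤g = +-mono-≤ (f≤g zero) (sum-mono-≤ (λ i → f≤g (suc i)))

sum-const : ∀ k c → ∑[ i < k ] c ≡ k * c
sum-const zero    c = refl
sum-const (suc k) c = cong (c +_) (sum-const k c)

∣b∷p∣≡𝟙b+∣p∣ : ∀ {k} b (p : Subset k) → ∣ b ∷ p ∣ ≡ 𝟙 b + ∣ p ∣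
∣b∷p∣≡𝟙b+∣p∣ true  p = refl
∣b∷p∣≡𝟙b+∣p∣ false p = refl

∣tabulate∣≡∑𝟙 : ∀ {k} (f : Fin k → Bool) → ∣ tabulate f ∣ ≡ ∑[ i < k ] 𝟙 (f i)
∣tabulate∣≡∑𝟙 {zero}  f = refl
∣tabulate∣≡∑𝟙 {suc k} f = trans (∣b∷p∣≡𝟙b+∣p∣ (f zero) (tabulate (λ i → f (suc i))))
  (cong (𝟙 (f zero) +_) (∣tabulate∣≡∑𝟙 (λ i → f (suc i))))

tabulate-∩ : ∀ {k} (f g : Fin k → Bool) →
  tabulate f ∩ tabulate g ≡ tabulate (λ i → f i ∧ g i)
tabulate-∩ {zero}  f g = refl
tabulate-∩ {suc k} f g = cong (f zero ∧ g zero ∷_) (tabulate-∩ (λ i → f (suc i)) (λ i → g (suc i)))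

∣⁅i⁆∩tabulate∣≡𝟙 : ∀ {k} (i : Fin k) (f : Fin k → Bool) → ∣ ⁅ i ⁆ ∩ tabulate f ∣ ≡ 𝟙 (f i)
∣⁅i⁆∩tabulate∣≡𝟙 {suc k} zero f = begin
  ∣ f zero ∷ (⊥ ∩ rest) ∣    ≡⟨ ∣b∷p∣≡𝟙b+∣p∣ (f zero) (⊥ ∩ rest) ⟩
  𝟙 (f zero) + ∣ ⊥ ∩ rest ∣  ≡⟨ cong (λ p → 𝟙 (f zero) + ∣ p ∣) (∩-zeroˡ rest) ⟩
  𝟙 (f zero) + ∣ ⊥ {k} ∣     ≡⟨ cong (𝟙 (f zero) +_) (∣⊥∣≡0 k) ⟩
  𝟙 (f zero) + 0             ≡⟨ +-identityʳ (𝟙 (f zero)) ⟩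
  𝟙 (f zero)                 ∎
  where
  open ≡-Reasoning
  rest : Subset k
  rest = tabulate (λ i → f (suc i))
∣⁅i⁆∩tabulate∣≡𝟙 (suc i) f = ∣⁅i⁆∩tabulate∣≡𝟙 i (λ j → f (suc j))

module _ {n m : ℕ} (G : BipGraph n m) where

  codegree : Fin n → Fin n → ℕ
  codegree x x′ = ∣ nbrX G x ∩ nbrX G x′ ∣

  codegree-self : ∀ x → codegree x x ≡ degX G x
  codegree-self x = cong ∣_∣ (∩-idem (nbrX G x))

  codegree≡∑𝟙*𝟙 : ∀ x x′ → codegree x x′ ≡ ∑[ y < m ] (𝟙 (G x y) * 𝟙 (G x′ y))
  codegree≡∑𝟙*𝟙 x x′ = begin
    ∣ tabulate (G x) ∩ tabulate (G x′) ∣          ≡⟨ cong ∣_∣ (tabulate-∩ (G x) (G x′)) ⟩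
    ∣ tabulate (λ y → G x y ∧ G x′ y) ∣           ≡⟨ ∣tabulate∣≡∑𝟙 (λ y → G x y ∧ G x′ y) ⟩
    ∑[ y < m ] 𝟙 (G x y ∧ G x′ y)                 ≡⟨ sum-cong-≗ (λ y → 𝟙-∧ (G x y) (G x′ y)) ⟩
    ∑[ y < m ] (𝟙 (G x y) * 𝟙 (G x′ y))           ∎
    where open ≡-Reasoning

  ∑-codegree : ∀ x₀ → ∑[ x < n ] codegree x₀ x ≡ ∑[ y < m ] (𝟙 (G x₀ y) * degY G y)
  ∑-codegree x₀ = begin
    ∑[ x < n ] codegree x₀ x
      ≡⟨ sum-cong-≗ (codegree≡∑𝟙*𝟙 x₀) ⟩
    ∑[ x < n ] ∑[ y < m ] (𝟙 (G x₀ y) * 𝟙 (G x y))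
      ≡⟨ ∑-comm (λ x y → 𝟙 (G x₀ y) * 𝟙 (G x y)) ⟩
    ∑[ y < m ] ∑[ x < n ] (𝟙 (G x₀ y) * 𝟙 (G x y))
      ≡⟨ sum-cong-≗ (λ y → *-distribˡ-sum (𝟙 (G x₀ y)) (λ x → 𝟙 (G x y))) ⟨
    ∑[ y < m ] (𝟙 (G x₀ y) * ∑[ x < n ] 𝟙 (G x y))
      ≡⟨ sum-cong-≗ (λ y → cong (𝟙 (G x₀ y) *_) (∣tabulate∣≡∑𝟙 (λ x → G x y))) ⟨
    ∑[ y < m ] (𝟙 (G x₀ y) * degY G y)
      ∎
    where open ≡-Reasoning

  ∑-codegree≤degX*d : ∀ {d} → (∀ y → degY G y ≤ d) → ∀ x₀ →
    ∑[ x < n ] codegree x₀ x ≤ degX G x₀ * d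
  ∑-codegree≤degX*d {d} degY≤d x₀ = begin
    ∑[ x < n ] codegree x₀ x              ≡⟨ ∑-codegree x₀ ⟩
    ∑[ y < m ] (𝟙 (G x₀ y) * degY G y)    ≤⟨ sum-mono-≤ (λ y → *-monoʳ-≤ (𝟙 (G x₀ y)) (degY≤d y)) ⟩
    ∑[ y < m ] (𝟙 (G x₀ y) * d)           ≡⟨ *-distribʳ-sum d (λ y → 𝟙 (G x₀ y)) ⟨
    ∑[ y < m ] 𝟙 (G x₀ y) * d             ≡⟨ cong (_* d) (∣tabulate∣≡∑𝟙 (G x₀)) ⟨
    degX G x₀ * d                         ∎
    where open ≤-Reasoning

Λ²-pair : ∀ {n m} (G : BipGraph (suc n) m) (i : Fin n) →
  Λ² G (inside ∷ ⁅ i ⁆) ≡ nbrX G zero ∩ nbrX G (suc i)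
Λ²-pair G i = begin
  tabulate (λ y → 2 ≤ᵇ ∣ (inside ∷ ⁅ i ⁆) ∩ nbrY G y ∣) ≡⟨ tabulate-cong Λ²-membership ⟩
  tabulate (λ y → G zero y ∧ G (suc i) y)               ≡⟨ tabulate-∩ (G zero) (G (suc i)) ⟨
  nbrX G zero ∩ nbrX G (suc i)                          ∎
  where
  open ≡-Reasoning
  Λ²-membership : ∀ y → (2 ≤ᵇ ∣ (inside ∷ ⁅ i ⁆) ∩ nbrY G y ∣) ≡ G zero y ∧ G (suc i) y
  Λ²-membership y = begin
    2 ≤ᵇ ∣ G zero y ∷ (⁅ i ⁆ ∩ tabulate (λ x → G (suc x) y)) ∣
      ≡⟨ cong (2 ≤ᵇ_) (∣b∷p∣≡𝟙b+∣p∣ (G zero y) (⁅ i ⁆ ∩ tabulate (λ x → G (suc x) y))) ⟩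
    2 ≤ᵇ 𝟙 (G zero y) + ∣ ⁅ i ⁆ ∩ tabulate (λ x → G (suc x) y) ∣
      ≡⟨ cong (λ c → 2 ≤ᵇ 𝟙 (G zero y) + c) (∣⁅i⁆∩tabulate∣≡𝟙 i (λ x → G (suc x) y)) ⟩
    2 ≤ᵇ 𝟙 (G zero y) + 𝟙 (G (suc i) y)
      ≡⟨ 2≤ᵇ𝟙+𝟙 (G zero y) (G (suc i) y) ⟩
    G zero y ∧ G (suc i) y ∎

2*[nC2]≡n*[n∸1] : ∀ n → 2 * (n C 2) ≡ n * (n ∸ 1)
2*[nC2]≡n*[n∸1] zero          = refl
2*[nC2]≡n*[n∸1] (suc zero)    = refl
2*[nC2]≡n*[n∸1] (suc (suc n)) = begin
  2 * (suc (suc n) C 2)               ≡⟨ cong (2 *_) (nCk+nC[k+1]≡[n+1]C[k+1] (suc n) 1) ⟨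
  2 * (suc n C 1 + suc n C 2)         ≡⟨ *-distribˡ-+ 2 (suc n C 1) (suc n C 2) ⟩
  2 * (suc n C 1) + 2 * (suc n C 2)   ≡⟨ cong₂ (λ a b → 2 * a + b) (nC1≡n (suc n))
                                                (2*[nC2]≡n*[n∸1] (suc n)) ⟩
  2 * suc n + suc n * n               ≡⟨ solve 1 (λ n → con 2 :* (con 1 :+ n) :+ (con 1 :+ n) :* n
                                                    := (con 2 :+ n) :* (con 1 :+ n)) refl n ⟩
  suc (suc n) * suc n                 ∎
  where
  open ≡-Reasoning
  open +-*-Solver

2*b≤n*[n∸1]⇒b≤nC2 : ∀ {b} n → 2 * b ≤ n * (n ∸ 1) → b ≤ n C 2
2*b≤n*[n∸1]⇒b≤nC2 {b} n 2b≤ = *-cancelˡ-≤ 2 (subst (2 * b ≤_) (sym (2*[nC2]≡n*[n∸1] n)) 2b≤)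

n*[n∸1]+2≤n*n : ∀ n → 0 < n * (n ∸ 1) → n * (n ∸ 1) + 2 ≤ n * n
n*[n∸1]+2≤n*n (suc (suc n)) _ = begin
  suc (suc n) * suc n + 2             ≡⟨ +-comm (suc (suc n) * suc n) 2 ⟩
  2 + suc (suc n) * suc n             ≤⟨ +-monoˡ-≤ (suc (suc n) * suc n) (s≤s (s≤s z≤n)) ⟩
  suc (suc n) + suc (suc n) * suc n   ≡⟨ *-suc (suc (suc n)) (suc n) ⟨
  suc (suc n) * suc (suc n)           ∎
  where open ≤-Reasoning

a+b≤a*n⇒b≤n*[n∸1] : ∀ {a b} n → a + b ≤ a * n → a ≤ n → b ≤ n * (n ∸ 1)
a+b≤a*n⇒b≤n*[n∸1] {a} {b} zero    a+b≤ _   =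
  ≤-trans (m+n≤o⇒n≤o a (≤-trans a+b≤ (≤-reflexive (*-zeroʳ a)))) z≤n
a+b≤a*n⇒b≤n*[n∸1] {a} {b} (suc n) a+b≤ a≤n = begin
  b           ≤⟨ +-cancelˡ-≤ a b (a * n) (≤-trans a+b≤ (≤-reflexive (*-suc a n))) ⟩
  a * n       ≤⟨ *-monoˡ-≤ n a≤n ⟩
  suc n * n   ∎
  where open ≤-Reasoning

theorem1p10 : (n m d : ℕ) (G : BipGraph n m) → 2 ≤ n → DoubleHall G →
    MaxDegree G d → (n ≤ (d C 2) + 1) × (2 * n ≤ d * d)
theorem1p10 (suc (suc k)) m d G (s≤s (s≤s z≤n)) doubleHall (degX≤d , degY≤d , _) =
  n≤dC2+1 , 2n≤d*d
  where
  codegree-pair≥2 : ∀ i → 2 ≤ codegree G zero (suc i)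
  codegree-pair≥2 i = subst (2 ≤_) (cong ∣_∣ (Λ²-pair G i))
    (≤-trans 2≤∣pair∣ (doubleHall (inside ∷ ⁅ i ⁆) 2≤∣pair∣))
    where
    2≤∣pair∣ : 2 ≤ ∣ inside ∷ ⁅ i ⁆ ∣
    2≤∣pair∣ = ≤-reflexive (cong suc (sym (∣⁅x⁆∣≡1 i)))

  counting : degX G zero + 2 * suc k ≤ degX G zero * d
  counting = begin
    degX G zero + 2 * suc k
      ≡⟨ cong₂ _+_ (codegree-self G zero) (trans (sum-const (suc k) 2) (*-comm (suc k) 2)) ⟨
    codegree G zero zero + ∑[ i < suc k ] 2
      ≤⟨ +-monoʳ-≤ (codegree G zero zero) (sum-mono-≤ codegree-pair≥2) ⟩
    codegree G zero zero + ∑[ i < suc k ] codegree G zero (suc i)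
      ≤⟨ ∑-codegree≤degX*d G degY≤d zero ⟩
    degX G zero * d
      ∎
    where open ≤-Reasoning

  2[k+1]≤d*[d∸1] : 2 * suc k ≤ d * (d ∸ 1)
  2[k+1]≤d*[d∸1] = a+b≤a*n⇒b≤n*[n∸1] d counting (degX≤d zero)

  n≤dC2+1 : suc (suc k) ≤ d C 2 + 1
  n≤dC2+1 = subst (suc (suc k) ≤_) (+-comm 1 (d C 2)) (s≤s (2*b≤n*[n∸1]⇒b≤nC2 d 2[k+1]≤d*[d∸1]))

  2n≤d*d : 2 * suc (suc k) ≤ d * d
  2n≤d*d = begin
    2 * suc (suc k)      ≡⟨ trans (*-suc 2 (suc k)) (+-comm 2 (2 * suc k)) ⟩
    2 * suc k + 2        ≤⟨ +-monoˡ-≤ 2 2[k+1]≤d*[d∸1] ⟩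
    d * (d ∸ 1) + 2      ≤⟨ n*[n∸1]+2≤n*n d (<-≤-trans (s≤s z≤n) 2[k+1]≤d*[d∸1]) ⟩
    d * d                ∎
    where open ≤-Reasoning
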